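{- For every $q\ge 2$, Bob has a winning strategy in the canonical ESD labeling game on the complete bipartite graph $K_{2,q}$.
   Context: For a graph $G=(V,E)$ and $l\in\mathbb N$, a vertex labeling $\phi:V\to\{1,\dots,l\}$ is an edge-sum distinguishing (ESD) labeling if $\phi$ is injective and the edge-weights $w_\phi(uv)=\phi(u)+\phi(v)$ are pairwise distinct over all edges $uv\in E$. ESD labeling game on $G$ with label set $L=\{1,\dots,l\}$: Alice and Bob alternate moves, Alice starting. In each move the player chooses a not-yet-labeled vertex and assigns to it a label from $L$ not used before; the move is legal if the edge-weights of edges with both endpoints labeled remain pairwise distinct. The game ends when no legal move is possible or an ESD labeling of $G$ is created; Alice wins if an ESD labeling is created, otherwise Bob wins. The game is canonical if $|L|=|V(G)|$. -}

module Defs where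

open import Data.Nat using (ℕ; _+_; _≤_; _<_)
open import Data.Fin using (Fin; toℕ; _≟_)
open import Data.Maybe using (Maybe; just; nothing)
open import Data.Product using (Σ; _×_; _,_)
open import Data.Sum using (_⊎_)
open import Data.Empty using (⊥)
open import Relation.Nullary using (¬_; yes; no)
open import Relation.Binary.PropositionalEquality using (_≡_; _≢_)

-- A (simple, undirected) graph on vertex set Fin n; Adj is assumed symmetric
-- and irreflexive for the graphs we build.  An edge is an unordered pair {u,v}
-- with Adj u v.
record Graph : Set₁ where
  field
    n   : ℕ
    Adj : Fin n → Fin n → Set
open Graph public

K2 : ℕ → Graph
K2 q = record
  { n   = 2 + q
  ; Adj = λ u v → (toℕ u < 2 × 2 ≤ toℕ v) ⊎ (2 ≤ toℕ u × toℕ v < 2)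
  }

Position : Graph → Set
Position G = Fin (n G) → Maybe ℕ

emptyPos : (G : Graph) → Position G
emptyPos G _ = nothing

update : {G : Graph} → Position G → Fin (n G) → ℕ → Position G
update s v a u with u ≟ v
... | yes _ = just a
... | no  _ = s u

DistinctWeights : (G : Graph) → Position G → Set
DistinctWeights G s =
  ∀ u v x y a b c d →
  Adj G u v → Adj G x y →
  s u ≡ just a → s v ≡ just b → s x ≡ just c → s y ≡ just d →
  a + b ≡ c + d →
  (u ≡ x × v ≡ y) ⊎ (u ≡ y × v ≡ x)

record Move (G : Graph) (l : ℕ) (s : Position G) : Set where
  constructor move
  field
    vertex     : Fin (n G)
    label      : ℕ
    unlabeled  : s vertex ≡ nothing
    label≥1    : 1 ≤ label
    label≤l    : label ≤ l
    unused     : ∀ u → s u ≢ just label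
    legal      : DistinctWeights G (update {G} s vertex label)
open Move public

result : {G : Graph} {l : ℕ} {s : Position G} → Move G l s → Position G
result {G} {s = s} m = update {G} s (vertex m) (label m)

-- Every vertex is labeled (in a play, this means an ESD labeling was created).
Complete : (G : Graph) → Position G → Set
Complete G s = ∀ v → Σ ℕ λ a → s v ≡ just a

-- Alice wins iff a complete labeling is reached; the game stops when a
-- complete labeling is reached or the player to move has no legal move.
mutual
  data BobWinsAliceToMove (G : Graph) (l : ℕ) (s : Position G) : Set where
    aliceTurn : ¬ Complete G s →
                ((m : Move G l s) → BobWinsBobToMove G l (result m)) →
                BobWinsAliceToMove G l s

  data BobWinsBobToMove (G : Graph) (l : ℕ) (s : Position G) : Set where
    bobStuck : ¬ Complete G s → ¬ Move G l s → BobWinsBobToMove G l s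
    bobMoves : ¬ Complete G s → (m : Move G l s) →
               BobWinsAliceToMove G l (result m) → BobWinsBobToMove G l s

BobWinsESDGame : (G : Graph) → ℕ → Set
BobWinsESDGame G l = BobWinsAliceToMove G l (emptyPos G)

module Submission where

-- Bob only has to think once.  Call a position doomed if no complete
-- valid labelling extends it.  From a valid doomed position Bob wins by
-- playing any legal move, because the game is finite and can never end
-- in an ESD labelling (this needs legal moves to be decidable).  Hence it
-- suffices that Bob can answer every opening move of Alice by a move that
-- dooms the position.
--
-- In a complete valid canonical labelling of K_{2,q} all labels 1,…,q+2
-- occur, so if the centres carry x and y there are no two leaf labels p,r
-- with x + p = y + r; such a pair is called an obstruction.  For q ≥ 3
-- Bob labels a centre with 2 or q+1 (whichever Alice did not use): every
-- label of the other centre then yields an obstruction.  For q = 2 Bob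
-- makes a centre and a leaf carry complementary labels x and 5 - x; the
-- other centre label y then yields the obstruction (5 - x, 5 - y).

open import Defs
open import Data.Nat using (ℕ; zero; suc; _+_; _≤_; _<_; z≤n; s≤s)
open import Data.Nat.Properties
  using (≤-refl; ≤-trans; ≤-pred; <⇒≢; <⇒≱; ≤∧≢⇒<; n≤1+n; n<1+n; 1+n≢0; 1+n≰n;
         +-comm; +-suc; +-cancelˡ-≡; m≤n⇒m<n∨m≡n)
  renaming (suc-injective to ℕ-suc-injective; _≟_ to _≟ℕ_; _<?_ to _<?ℕ_; _≤?_ to _≤?ℕ_)
open import Data.Fin using (Fin; zero; suc; toℕ; _≟_; fromℕ<; punchOut)
open import Data.Fin.Properties
  using (any?; all?; punchOut-injective; toℕ-fromℕ<; toℕ<n; injective⇒≤)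
  renaming (suc-injective to fin-suc-injective)
open import Data.Maybe using (Maybe; just; nothing)
open import Data.Maybe.Properties using (just-injective)
open import Data.Product using (∃; _×_; _,_; proj₁; proj₂)
open import Data.Sum using (_⊎_; inj₁; inj₂)
open import Data.Empty using (⊥; ⊥-elim)
open import Function.Definitions using (Injective)
open import Relation.Nullary using (¬_; Dec; yes; no; contradiction)
open import Relation.Nullary.Decidable using (map′; _×-dec_; _⊎-dec_; _→-dec_)
open import Relation.Binary.PropositionalEquality
  using (_≡_; _≢_; refl; sym; trans; cong; subst)

update-same : ∀ {G} (s : Position G) v a → update {G} s v a v ≡ just a
update-same s v a with v ≟ v
... | yes _  = refl
... | no v≢v = contradiction refl v≢v

update-other : ∀ {G} (s : Position G) v a u → u ≢ v → update {G} s v a u ≡ s u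
update-other s v a u u≢v with u ≟ v
... | yes u≡v = contradiction u≡v u≢v
... | no _    = refl

update-cases : ∀ {G} (s : Position G) v a u b → update {G} s v a u ≡ just b →
               (u ≡ v × a ≡ b) ⊎ s u ≡ just b
update-cases s v a u b e with u ≟ v
... | yes u≡v = inj₁ (u≡v , just-injective e)
... | no _    = inj₂ e

InRange : ℕ → ℕ → Set
InRange l a = 1 ≤ a × a ≤ l

-- The invariant of every position reached in the game: edge-weights are
-- distinct, labels lie in {1,…,l} and no label is used twice.
record Valid (G : Graph) (l : ℕ) (s : Position G) : Set where
  field
    distinct-weights : DistinctWeights G s
    in-range         : ∀ v a → s v ≡ just a → InRange l a
    injective        : ∀ u v a → s u ≡ just a → s v ≡ just a → u ≡ v
open Valid

labels-separate : ∀ {m} {s : Fin m → Maybe ℕ} {u v a b} →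
                  s u ≡ just a → s v ≡ just b → a ≢ b → u ≢ v
labels-separate su sv a≢b refl = a≢b (just-injective (trans (sym su) sv))

DecAdj : Graph → Set
DecAdj G = ∀ u v → Dec (Adj G u v)

SameWeight : Maybe ℕ → Maybe ℕ → Maybe ℕ → Maybe ℕ → Set
SameWeight (just a) (just b) (just c) (just d) = a + b ≡ c + d
SameWeight _        _        _        _        = ⊥

sameWeight? : ∀ ma mb mc md → Dec (SameWeight ma mb mc md)
sameWeight? nothing  _        _        _        = no λ ()
sameWeight? (just _) nothing  _        _        = no λ ()
sameWeight? (just _) (just _) nothing  _        = no λ ()
sameWeight? (just _) (just _) (just _) nothing  = no λ ()
sameWeight? (just a) (just b) (just c) (just d) = a + b ≟ℕ c + d

sameWeight-intro : ∀ {ma mb mc md a b c d} → ma ≡ just a → mb ≡ just b →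
                   mc ≡ just c → md ≡ just d → a + b ≡ c + d → SameWeight ma mb mc md
sameWeight-intro refl refl refl refl e = e

SameEdge : ∀ {m} → (u v x y : Fin m) → Set
SameEdge u v x y = (u ≡ x × v ≡ y) ⊎ (u ≡ y × v ≡ x)

-- DistinctWeights quantifies over labels, which range over all of ℕ; this
-- equivalent form quantifies over vertices only, hence is decidable.
DistinctWeightsᵛ : (G : Graph) → Position G → Set
DistinctWeightsᵛ G s = ∀ u v x y → Adj G u v → Adj G x y →
                       SameWeight (s u) (s v) (s x) (s y) → SameEdge u v x y

distinctWeights⇒ᵛ : ∀ {G} (s : Position G) → DistinctWeights G s → DistinctWeightsᵛ G s
distinctWeights⇒ᵛ s dw u v x y uv xy same
  with s u in su | s v in sv | s x in sx | s y in sy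
... | nothing | _       | _       | _       = ⊥-elim same
... | just _  | nothing | _       | _       = ⊥-elim same
... | just _  | just _  | nothing | _       = ⊥-elim same
... | just _  | just _  | just _  | nothing = ⊥-elim same
... | just a  | just b  | just c  | just d  = dw u v x y a b c d uv xy su sv sx sy same

distinctWeightsᵛ⇒ : ∀ {G} (s : Position G) → DistinctWeightsᵛ G s → DistinctWeights G s
distinctWeightsᵛ⇒ s dw u v x y a b c d uv xy su sv sx sy e =
  dw u v x y uv xy (sameWeight-intro su sv sx sy e)

distinctWeights? : ∀ {G} → DecAdj G → (s : Position G) → Dec (DistinctWeights G s)
distinctWeights? adj? s = map′ (distinctWeightsᵛ⇒ s) (distinctWeights⇒ᵛ s)
  (all? λ u → all? λ v → all? λ x → all? λ y →
     adj? u v →-dec adj? x y →-dec sameWeight? (s u) (s v) (s x) (s y) →-dec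
     (((u ≟ x) ×-dec (v ≟ y)) ⊎-dec ((u ≟ y) ×-dec (v ≟ x))))

LegalLabel : (G : Graph) → Position G → Fin (n G) → ℕ → Set
LegalLabel G s v a = s v ≡ nothing × (∀ u → s u ≢ just a) × DistinctWeights G (update {G} s v a)

legalLabel? : ∀ {G} → DecAdj G → (s : Position G) → ∀ v a → Dec (LegalLabel G s v a)
legalLabel? {G} adj? s v a =
  unlabelled? (s v) ×-dec all? (λ u → unused? (s u)) ×-dec distinctWeights? adj? (update {G} s v a)
  where
  unlabelled? : (m : Maybe ℕ) → Dec (m ≡ nothing)
  unlabelled? nothing  = yes refl
  unlabelled? (just _) = no λ ()
  unused? : (m : Maybe ℕ) → Dec (m ≢ just a)
  unused? nothing  = yes λ ()
  unused? (just b) with b ≟ℕ a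
  ... | yes refl = no λ ne → ne refl
  ... | no b≢a   = yes λ e → b≢a (just-injective e)

-- Whether a legal move exists is decidable: search all vertices and all
-- labels 1,…,l (label i+1 is represented by i : Fin l).
move? : ∀ {G l} → DecAdj G → (s : Position G) → Dec (Move G l s)
move? {G} {l} adj? s
  with any? (λ v → any? (λ (i : Fin l) → legalLabel? adj? s v (suc (toℕ i))))
... | yes (v , i , free , unused , legal) =
  yes (move v (suc (toℕ i)) free (s≤s z≤n) (toℕ<n i) unused legal)
... | no none = no λ m → none (witness m)
  where
  witness : Move G l s → ∃ λ v → ∃ λ (i : Fin l) → LegalLabel G s v (suc (toℕ i))
  witness (move v (suc a) free _ a<l unused legal) =
    v , fromℕ< a<l ,
    subst (λ b → LegalLabel G s v (suc b)) (sym (toℕ-fromℕ< a<l)) (free , unused , legal)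

isUnlabelled : Maybe ℕ → ℕ
isUnlabelled nothing  = 1
isUnlabelled (just _) = 0

unlabelled : ∀ {m} → (Fin m → Maybe ℕ) → ℕ
unlabelled {zero}  s = 0
unlabelled {suc m} s = isUnlabelled (s zero) + unlabelled (λ i → s (suc i))

unlabelled-cong : ∀ {m} (s t : Fin m → Maybe ℕ) → (∀ u → t u ≡ s u) →
                  unlabelled t ≡ unlabelled s
unlabelled-cong {zero}  s t t≗s = refl
unlabelled-cong {suc m} s t t≗s rewrite t≗s zero =
  cong (isUnlabelled (s zero) +_)
       (unlabelled-cong (λ i → s (suc i)) (λ i → t (suc i)) (λ i → t≗s (suc i)))

unlabelled-fill : ∀ {m} (s t : Fin m → Maybe ℕ) v a → (∀ u → u ≢ v → t u ≡ s u) →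
                  s v ≡ nothing → t v ≡ just a → suc (unlabelled t) ≡ unlabelled s
unlabelled-fill {suc m} s t zero a same sv tv rewrite sv | tv =
  cong suc (unlabelled-cong (λ i → s (suc i)) (λ i → t (suc i)) (λ i → same (suc i) λ ()))
unlabelled-fill {suc m} s t (suc v) a same sv tv rewrite same zero (λ ()) =
  trans (sym (+-suc (isUnlabelled (s zero)) _))
        (cong (isUnlabelled (s zero) +_) (unlabelled-fill (λ i → s (suc i)) (λ i → t (suc i)) v a
                        (λ u u≢v → same (suc u) λ e → u≢v (fin-suc-injective e))
                        sv tv))

move-shrinks : ∀ {G l s} (m : Move G l s) → suc (unlabelled (result m)) ≡ unlabelled s
move-shrinks {G} {s = s} m =
  unlabelled-fill s (result m) (vertex m) (label m)
    (update-other {G} s (vertex m) (label m)) (unlabeled m) (update-same {G} s (vertex m) (label m))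

move-valid : ∀ {G l s} → Valid G l s → (m : Move G l s) → Valid G l (result m)
move-valid {G} {l} {s} V m = record
  { distinct-weights = legal m ; in-range = range ; injective = inj }
  where
  range : ∀ w b → result m w ≡ just b → InRange l b
  range w b e with update-cases {G} s (vertex m) (label m) w b e
  ... | inj₁ (_ , refl) = label≥1 m , label≤l m
  ... | inj₂ old        = in-range V w b old
  inj : ∀ u v b → result m u ≡ just b → result m v ≡ just b → u ≡ v
  inj u v b eu ev with update-cases {G} s (vertex m) (label m) u b eu
                     | update-cases {G} s (vertex m) (label m) v b ev
  ... | inj₁ (u≡ , _)    | inj₁ (v≡ , _)    = trans u≡ (sym v≡)
  ... | inj₁ (_ , refl)  | inj₂ old         = contradiction old (unused m v)
  ... | inj₂ old         | inj₁ (_ , refl)  = contradiction old (unused m u)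
  ... | inj₂ old₁        | inj₂ old₂        = injective V u v b old₁ old₂

Extends : ∀ {m} → (Fin m → Maybe ℕ) → (Fin m → Maybe ℕ) → Set
Extends s t = ∀ w a → s w ≡ just a → t w ≡ just a

Doomed : (G : Graph) → ℕ → Position G → Set
Doomed G l s = ∀ t → Extends s t → Complete G t → Valid G l t → ⊥

move-doomed : ∀ {G l s} → Doomed G l s → (m : Move G l s) → Doomed G l (result m)
move-doomed {G} {s = s} D m t ext = D t λ w a sw → ext w a (keep w a sw)
  where
  keep : Extends s (result m)
  keep w a sw with w ≟ vertex m
  ... | yes refl = contradiction (trans (sym (unlabeled m)) sw) λ ()
  ... | no _     = sw

doomed-incomplete : ∀ {G l s} → Valid G l s → Doomed G l s → ¬ Complete G s
doomed-incomplete {s = s} V D complete = D s (λ _ _ e → e) complete V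

module _ {G : Graph} {l : ℕ} (adj? : DecAdj G) where

  mutual
    doomed-aliceToMove : ∀ k s → unlabelled s ≡ k → Valid G l s → Doomed G l s →
                         BobWinsAliceToMove G l s
    doomed-aliceToMove zero s size V D = aliceTurn (doomed-incomplete V D)
      λ m → contradiction (trans (move-shrinks m) size) 1+n≢0
    doomed-aliceToMove (suc k) s size V D = aliceTurn (doomed-incomplete V D)
      λ m → doomed-bobToMove k (result m) (ℕ-suc-injective (trans (move-shrinks m) size))
              (move-valid V m) (move-doomed D m)

    doomed-bobToMove : ∀ k s → unlabelled s ≡ k → Valid G l s → Doomed G l s →
                       BobWinsBobToMove G l s
    doomed-bobToMove k s size V D with move? adj? s
    ... | no stuck = bobStuck (doomed-incomplete V D) stuck
    doomed-bobToMove zero    s size V D | yes m =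
      contradiction (trans (move-shrinks m) size) 1+n≢0
    doomed-bobToMove (suc k) s size V D | yes m =
      bobMoves (doomed-incomplete V D) m
        (doomed-aliceToMove k (result m) (ℕ-suc-injective (trans (move-shrinks m) size))
           (move-valid V m) (move-doomed D m))

record DoomingReply (G : Graph) (l : ℕ) (v : Fin (n G)) (a : ℕ) : Set where
  field
    bobVertex    : Fin (n G)
    bobLabel     : ℕ
    vertex-fresh : bobVertex ≢ v
    label-fresh  : bobLabel ≢ a
    label-range  : InRange l bobLabel
    dooms        : ∀ t → Complete G t → Valid G l t →
                   t v ≡ just a → t bobVertex ≡ just bobLabel → ⊥
open DoomingReply

DoomingStrategy : Graph → ℕ → Set
DoomingStrategy G l = ∀ v a → InRange l a → DoomingReply G l v a

edge-within : ∀ {G} → (∀ u → ¬ Adj G u u) → ∀ {u v p q} → Adj G u v →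
              u ≡ p ⊎ u ≡ q → v ≡ p ⊎ v ≡ q → SameEdge u v p q
edge-within loopless uv (inj₁ refl) (inj₁ refl) = ⊥-elim (loopless _ uv)
edge-within loopless uv (inj₁ refl) (inj₂ refl) = inj₁ (refl , refl)
edge-within loopless uv (inj₂ refl) (inj₁ refl) = inj₂ (refl , refl)
edge-within loopless uv (inj₂ refl) (inj₂ refl) = ⊥-elim (loopless _ uv)

twoLabels-distinct : ∀ {G} → (∀ u → ¬ Adj G u u) → (s : Position G) → ∀ p q →
                     (∀ u c → s u ≡ just c → u ≡ p ⊎ u ≡ q) → DistinctWeights G s
twoLabels-distinct loopless s p q labelled u v x y a b c d uv xy su sv sx sy _
  with edge-within loopless uv (labelled u a su) (labelled v b sv)
     | edge-within loopless xy (labelled x c sx) (labelled y d sy)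
... | inj₁ (refl , refl) | inj₁ (refl , refl) = inj₁ (refl , refl)
... | inj₁ (refl , refl) | inj₂ (refl , refl) = inj₂ (refl , refl)
... | inj₂ (refl , refl) | inj₁ (refl , refl) = inj₂ (refl , refl)
... | inj₂ (refl , refl) | inj₂ (refl , refl) = inj₁ (refl , refl)

emptyPos-valid : ∀ {G l} → Valid G l (emptyPos G)
emptyPos-valid = record { distinct-weights = λ _ _ _ _ _ _ _ _ _ _ ()
                        ; in-range = λ _ _ () ; injective = λ _ _ _ () }

module _ {G : Graph} {l : ℕ} (m₁ : Move G l (emptyPos G))
         (r : DoomingReply G l (vertex m₁) (label m₁)) where

  private
    v = vertex m₁
    a = label m₁
    s₁ = result m₁

  reply-vertex-free : s₁ (bobVertex r) ≡ nothing
  reply-vertex-free = update-other {G} (emptyPos G) v a (bobVertex r) (vertex-fresh r)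

  opening-only : ∀ u c → s₁ u ≡ just c → u ≡ v × a ≡ c
  opening-only u c e with update-cases {G} (emptyPos G) v a u c e
  ... | inj₁ labelled = labelled
  ... | inj₂ ()

  reply-move : (∀ u → ¬ Adj G u u) → Move G l s₁
  reply-move loopless = move (bobVertex r) (bobLabel r) reply-vertex-free
    (proj₁ (label-range r)) (proj₂ (label-range r))
    (λ u e → label-fresh r (sym (proj₂ (opening-only u (bobLabel r) e))))
    (twoLabels-distinct loopless _ v (bobVertex r) only-two)
    where
    only-two : ∀ u c → update {G} s₁ (bobVertex r) (bobLabel r) u ≡ just c →
               u ≡ v ⊎ u ≡ bobVertex r
    only-two u c e with update-cases {G} s₁ (bobVertex r) (bobLabel r) u c e
    ... | inj₁ (u≡w , _) = inj₂ u≡w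
    ... | inj₂ old       = inj₁ (proj₁ (opening-only u c old))

  reply-dooms : (loopless : ∀ u → ¬ Adj G u u) → Doomed G l (result (reply-move loopless))
  reply-dooms loopless t ext complete V = dooms r t complete V (ext v a labelled-v)
    (ext (bobVertex r) (bobLabel r) (update-same {G} s₁ (bobVertex r) (bobLabel r)))
    where
    labelled-v : result (reply-move loopless) v ≡ just a
    labelled-v = trans (update-other {G} s₁ (bobVertex r) (bobLabel r) v (λ e → vertex-fresh r (sym e)))
                       (update-same {G} (emptyPos G) v a)

bobWins-by-doomingReply : ∀ {G l} → DecAdj G → (∀ u → ¬ Adj G u u) → Fin (n G) →
                          DoomingStrategy G l → BobWinsESDGame G l
bobWins-by-doomingReply {G} {l} adj? loopless v₀ strategy =
  aliceTurn (λ complete → contradiction (proj₂ (complete v₀)) λ ()) answer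
  where
  answer : (m₁ : Move G l (emptyPos G)) → BobWinsBobToMove G l (result m₁)
  answer m₁ = bobMoves
    (λ complete → contradiction
       (trans (sym (reply-vertex-free m₁ r)) (proj₂ (complete (bobVertex r)))) λ ())
    (reply-move m₁ r loopless)
    (doomed-aliceToMove adj? _ _ refl
      (move-valid (move-valid emptyPos-valid m₁) (reply-move m₁ r loopless))
      (reply-dooms m₁ r loopless))
    where
    r = strategy (vertex m₁) (label m₁) (label≥1 m₁ , label≤l m₁)

-- An injection of a finite set into itself is onto: a missed value would
-- give an injection Fin (m+1) → Fin m by punching it out.
fin-injection-onto : ∀ {m} (f : Fin m → Fin m) → Injective _≡_ _≡_ f →
                     ∀ y → ∃ λ x → f x ≡ y
fin-injection-onto {suc m} f inj y with any? (λ x → f x ≟ y)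
... | yes hit = hit
... | no miss = contradiction (injective⇒≤ punched-injective) 1+n≰n
  where
  missed : ∀ x → y ≢ f x
  missed x e = miss (x , sym e)
  punched : Fin (suc m) → Fin m
  punched x = punchOut (missed x)
  punched-injective : Injective _≡_ _≡_ punched
  punched-injective {x₁} {x₂} e = inj (punchOut-injective (missed x₁) (missed x₂) e)

labelIndex : ∀ {m a} → InRange m a → Fin m
labelIndex {a = suc a} (_ , a<m) = fromℕ< a<m

labelIndex-injective : ∀ {m a b} (ra : InRange m a) (rb : InRange m b) →
                       labelIndex ra ≡ labelIndex rb → a ≡ b
labelIndex-injective {a = suc a} {suc b} (_ , a<m) (_ , b<m) e =
  cong suc (trans (sym (toℕ-fromℕ< a<m)) (trans (cong toℕ e) (toℕ-fromℕ< b<m)))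

-- A complete valid labelling of n G vertices by labels 1,…,n G is
-- injective, hence uses every label.
complete-onto : ∀ {G} (t : Position G) → Complete G t → Valid G (n G) t →
                ∀ z → InRange (n G) z → ∃ λ v → t v ≡ just z
complete-onto {G} t complete V z rz =
  found (fin-injection-onto index index-injective (labelIndex rz))
  where
  range : ∀ v → InRange (n G) (proj₁ (complete v))
  range v = in-range V v _ (proj₂ (complete v))
  index : Fin (n G) → Fin (n G)
  index v = labelIndex (range v)
  index-injective : Injective _≡_ _≡_ index
  index-injective {u} {v} e = injective V u v _ (proj₂ (complete u))
    (trans (proj₂ (complete v)) (cong just (sym (labelIndex-injective (range u) (range v) e))))
  found : (∃ λ v → index v ≡ labelIndex rz) → ∃ λ v → t v ≡ just z
  found (v , e) = v , trans (proj₂ (complete v)) (cong just (labelIndex-injective (range v) rz e))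

adjacent? : ∀ q → DecAdj (K2 q)
adjacent? q u v =
  ((toℕ u <?ℕ 2) ×-dec (2 ≤?ℕ toℕ v)) ⊎-dec ((2 ≤?ℕ toℕ u) ×-dec (toℕ v <?ℕ 2))

loopless : ∀ q u → ¬ Adj (K2 q) u u
loopless q u (inj₁ (u<2 , 2≤u)) = <⇒≱ u<2 2≤u
loopless q u (inj₂ (2≤u , u<2)) = <⇒≱ u<2 2≤u

data Centres {q : ℕ} : Fin (2 + q) → Fin (2 + q) → Set where
  centres₀₁ : Centres zero (suc zero)
  centres₁₀ : Centres (suc zero) zero

centres-swap : ∀ {q} {i j : Fin (2 + q)} → Centres i j → Centres j i
centres-swap centres₀₁ = centres₁₀
centres-swap centres₁₀ = centres₀₁

centres-distinct : ∀ {q} {i j : Fin (2 + q)} → Centres i j → i ≢ j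
centres-distinct centres₀₁ ()
centres-distinct centres₁₀ ()

leaf-adjacent : ∀ {q} {i j v : Fin (2 + q)} → Centres i j → v ≢ i → v ≢ j → Adj (K2 q) i v
leaf-adjacent {v = suc (suc _)} centres₀₁ _ _ = inj₁ (s≤s z≤n , s≤s (s≤s z≤n))
leaf-adjacent {v = suc (suc _)} centres₁₀ _ _ = inj₁ (s≤s (s≤s z≤n) , s≤s (s≤s z≤n))
leaf-adjacent {v = zero}        centres₀₁ v≢i _   = contradiction refl v≢i
leaf-adjacent {v = zero}        centres₁₀ _   v≢j = contradiction refl v≢j
leaf-adjacent {v = suc zero}    centres₀₁ _   v≢j = contradiction refl v≢j
leaf-adjacent {v = suc zero}    centres₁₀ v≢i _   = contradiction refl v≢i

leaf≢centre : ∀ {q} {i j : Fin (2 + q)} (v : Fin q) → Centres i j → suc (suc v) ≢ i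
leaf≢centre v centres₀₁ ()
leaf≢centre v centres₁₀ ()

-- With centre labels x and y, two further labels p, r ∈ {1,…,N} that
-- balance the centres: the edges x–p and y–r would have equal weight.
record Obstruction (N x y : ℕ) : Set where
  constructor obstruction
  field
    p r      : ℕ
    p-range  : InRange N p
    r-range  : InRange N r
    p≢x      : p ≢ x
    p≢y      : p ≢ y
    r≢x      : r ≢ x
    r≢y      : r ≢ y
    balanced : x + p ≡ y + r

Obstructed : ℕ → ℕ → ℕ → Set
Obstructed N x y = Obstruction N x y ⊎ Obstruction N y x

module _ {q : ℕ} {t : Position (K2 q)} (complete : Complete (K2 q) t)
         (V : Valid (K2 q) (2 + q) t) where

  -- The heart of the argument: all labels occur, so an obstruction yields
  -- two leaves whose edges to the two centres have the same weight.
  unobstructed : ∀ {i j x y} → Centres i j → t i ≡ just x → t j ≡ just y →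
                 ¬ Obstruction (2 + q) x y
  unobstructed {i} {j} {x} {y} c ti tj (obstruction p r rp rr p≢x p≢y r≢x r≢y balanced)
    with complete-onto t complete V p rp | complete-onto t complete V r rr
  ... | vp , tp | vr , tr
    with distinct-weights V i vp j vr x p y r
           (leaf-adjacent c (labels-separate tp ti p≢x) (labels-separate tp tj p≢y))
           (leaf-adjacent (centres-swap c) (labels-separate tr tj r≢y) (labels-separate tr ti r≢x))
           ti tp tj tr balanced
  ... | inj₁ (i≡j , _)  = centres-distinct c i≡j
  ... | inj₂ (_ , vp≡j) = labels-separate tp tj p≢y vp≡j

  other-centre : ∀ {i j x} → Centres i j → t i ≡ just x →
                 ∃ λ y → t j ≡ just y × y ≢ x × InRange (2 + q) y
  other-centre {i} {j} c ti with complete j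
  ... | y , tj = y , tj , (λ { refl → centres-distinct c (injective V i j y ti tj) }) ,
                 in-range V j y tj

  centre-dooms : ∀ {i j x} → Centres i j → t i ≡ just x →
                 (∀ y → InRange (2 + q) y → y ≢ x → Obstructed (2 + q) x y) → ⊥
  centre-dooms c ti obstructs with other-centre c ti
  ... | y , tj , y≢x , ry with obstructs y ry y≢x
  ...   | inj₁ o = unobstructed c ti tj o
  ...   | inj₂ o = unobstructed (centres-swap c) tj ti o

Complement : ℕ → Set
Complement a = ∃ λ b → InRange 4 b × b ≢ a × a + b ≡ 5

five-minus : ∀ a → InRange 4 a → Complement a
five-minus 0 (() , _)
five-minus 1 _ = 4 , (s≤s z≤n , ≤-refl) , (λ ()) , refl
five-minus 2 _ = 3 , (s≤s z≤n , n≤1+n 3) , (λ ()) , refl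
five-minus 3 _ = 2 , (s≤s z≤n , s≤s (s≤s z≤n)) , (λ ()) , refl
five-minus 4 _ = 1 , (s≤s z≤n , s≤s z≤n) , (λ ()) , refl
five-minus (suc (suc (suc (suc (suc _))))) (_ , s≤s (s≤s (s≤s (s≤s ()))))

-- If a centre and a leaf of K_{2,2} carry labels x and z with x + z = 5,
-- the other centre label y and r = 5 - y obstruct: x + z = 5 = y + r.
complement-dooms : ∀ {t : Position (K2 2)} → Complete (K2 2) t → Valid (K2 2) 4 t →
                   ∀ {i j w x z} → Centres i j → w ≢ i → w ≢ j →
                   t i ≡ just x → t w ≡ just z → x + z ≡ 5 → ⊥
complement-dooms complete V {i} {j} {w} {x} {z} c w≢i w≢j ti tw x+z≡5
  with other-centre complete V c ti
... | y , tj , _ , ry with five-minus y ry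
...   | r , rr , r≢y , y+r≡5 =
  unobstructed complete V c ti tj
    (obstruction z r (in-range V w z tw) rr z≢x z≢y r≢x r≢y (trans x+z≡5 (sym y+r≡5)))
  where
  z≢x : z ≢ x
  z≢x refl = w≢i (injective V w i z tw ti)
  z≢y : z ≢ y
  z≢y refl = w≢j (injective V w j z tw tj)
  r≢x : r ≢ x
  r≢x refl = z≢y (+-cancelˡ-≡ r z y (trans x+z≡5 (trans (sym y+r≡5) (+-comm y r))))

complement-on-leaf : ∀ {i j a} → Centres i j → Complement a → DoomingReply (K2 2) 4 i a
complement-on-leaf c (b , rb , b≢a , a+b≡5) = record
  { bobVertex = suc (suc zero) ; bobLabel = b ; vertex-fresh = leaf≢centre zero c
  ; label-fresh = b≢a ; label-range = rb
  ; dooms = λ t complete V ti tw → complement-dooms complete V c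
              (leaf≢centre zero c) (leaf≢centre zero (centres-swap c)) ti tw a+b≡5 }

complement-on-centre : ∀ {a} v → Complement a → DoomingReply (K2 2) 4 (suc (suc v)) a
complement-on-centre {a} v (b , rb , b≢a , a+b≡5) = record
  { bobVertex = zero ; bobLabel = b ; vertex-fresh = λ () ; label-fresh = b≢a
  ; label-range = rb
  ; dooms = λ t complete V tv tw → complement-dooms complete V centres₀₁ (λ ()) (λ ())
              tw tv (trans (+-comm b a) a+b≡5) }

q2-strategy : DoomingStrategy (K2 2) 4
q2-strategy zero          a ra = complement-on-leaf centres₀₁ (five-minus a ra)
q2-strategy (suc zero)    a ra = complement-on-leaf centres₁₀ (five-minus a ra)
q2-strategy (suc (suc v)) a ra = complement-on-centre v (five-minus a ra)

-- For q ≥ 3, with N = q + 2 = 5 + k, the centre labels 2 and N - 1 are fatal.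

-- 1 + N = 2 + (N-1),  2 + N = 3 + (N-1),  2 + (y-1) = y + 1  for y ≥ 4.
obstructed-by-2 : ∀ k y → InRange (5 + k) y → y ≢ 2 → Obstructed (5 + k) 2 y
obstructed-by-2 k 0 (() , _)
obstructed-by-2 k 1 _ _ = inj₂ (obstruction (5 + k) (4 + k) (s≤s z≤n , ≤-refl)
  (s≤s z≤n , n≤1+n _) (λ ()) (λ ()) (λ ()) (λ ()) refl)
obstructed-by-2 k 2 _ y≢2 = contradiction refl y≢2
obstructed-by-2 k 3 _ _ = inj₁ (obstruction (5 + k) (4 + k) (s≤s z≤n , ≤-refl)
  (s≤s z≤n , n≤1+n _) (λ ()) (λ ()) (λ ()) (λ ()) refl)
obstructed-by-2 k (suc (suc (suc (suc m)))) (_ , y≤N) _ = inj₁ (obstruction (3 + m) 1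
  (s≤s z≤n , ≤-trans (n≤1+n _) y≤N) (s≤s z≤n , s≤s z≤n)
  (λ ()) (<⇒≢ (n<1+n _)) (λ ()) (λ ()) (sym (cong (4 +_) (+-comm m 1))))

-- (N-1) + 2 = N + 1,  (N-2) + 2 = (N-1) + 1,  y + N = (N-1) + (y+1)  for y < N-2.
obstructed-by-4+k : ∀ k y → InRange (5 + k) y → y ≢ 4 + k → Obstructed (5 + k) (4 + k) y
obstructed-by-4+k k y (_ , y≤N) y≢4+k with m≤n⇒m<n∨m≡n y≤N
... | inj₂ refl = inj₁ (obstruction 2 1 (s≤s z≤n , s≤s (s≤s z≤n)) (s≤s z≤n , s≤s z≤n)
  (λ ()) (λ ()) (λ ()) (λ ()) (cong (4 +_) (+-suc k 1)))
... | inj₁ (s≤s y≤4+k) with m≤n⇒m<n∨m≡n (≤-pred (≤∧≢⇒< y≤4+k y≢4+k))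
...   | inj₂ refl = inj₂ (obstruction 2 1 (s≤s z≤n , s≤s (s≤s z≤n)) (s≤s z≤n , s≤s z≤n)
  (λ ()) (λ ()) (λ ()) (λ ()) (cong (3 +_) (+-suc k 1)))
...   | inj₁ y<3+k = inj₂ (obstruction (5 + k) (suc y) (s≤s z≤n , ≤-refl) (s≤s z≤n , y<N)
  (λ e → <⇒≢ y<N (sym e)) (λ e → <⇒≢ (n<1+n _) (sym e))
  (λ e → <⇒≢ (n<1+n y) (sym e)) (<⇒≢ (s≤s y<3+k))
  (trans (+-comm y (5 + k)) (sym (cong (4 +_) (+-suc k y)))))
  where
  y<N : y < 5 + k
  y<N = ≤-trans y<3+k (≤-trans (n≤1+n _) (n≤1+n _))

FatalLabel : ℕ → ℕ → Set
FatalLabel k a = ∃ λ b → b ≢ a × InRange (5 + k) b ×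
                 (∀ y → InRange (5 + k) y → y ≢ b → Obstructed (5 + k) b y)

fatal-label : ∀ k a → FatalLabel k a
fatal-label k a with a ≟ℕ 2
... | yes refl = 4 + k , (λ ()) , (s≤s z≤n , n≤1+n _) , obstructed-by-4+k k
... | no a≢2   = 2 , (λ e → a≢2 (sym e)) , (s≤s z≤n , s≤s (s≤s z≤n)) , obstructed-by-2 k

fatal-centre : ∀ {k v a i j} → Centres i j → i ≢ v → FatalLabel k a →
               DoomingReply (K2 (3 + k)) (5 + k) v a
fatal-centre {i = i} c i≢v (b , b≢a , rb , obstructs) = record
  { bobVertex = i ; bobLabel = b ; vertex-fresh = i≢v ; label-fresh = b≢a
  ; label-range = rb
  ; dooms = λ t complete V _ ti → centre-dooms complete V c ti obstructs }

q3-strategy : ∀ k → DoomingStrategy (K2 (3 + k)) (5 + k)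
q3-strategy k zero    a _ = fatal-centre centres₁₀ (λ ()) (fatal-label k a)
q3-strategy k (suc v) a _ = fatal-centre centres₀₁ (λ ()) (fatal-label k a)

theorem12 : (q : ℕ) → 2 ≤ q → BobWinsESDGame (K2 q) (n (K2 q))
theorem12 zero                ()
theorem12 (suc zero)          (s≤s ())
theorem12 (suc (suc zero))    _ =
  bobWins-by-doomingReply (adjacent? 2) (loopless 2) zero q2-strategy
theorem12 (suc (suc (suc k))) _ =
  bobWins-by-doomingReply (adjacent? (3 + k)) (loopless (3 + k)) zero (q3-strategy k)
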